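{- Let $\mathfrak{M}$ be a class of preference models s.t. for any $M\in\mathfrak{M}$ and any possible world $w$ in $M$ there is a characteristic formula $\xi_w\in \mathcal{L}_\leq(P)$, s.t. $M,w'\vDash \xi_w$ iff $w'=w$, and let $\star:\mathit{Mod}(\mathcal{L}_\leq)\times \mathcal{L}_0 \rightarrow \mathit{Mod}(\mathcal{L}_\leq)$ be a dynamic operator closed over $\mathfrak{M}$. It holds that $\star$ is $\mathfrak{M}$-DP1-compliant iff for any $M\in \mathfrak{M}$, any propositional formula $\varphi$ and worlds $w,w'\in [\![\varphi]\!]$ it holds that $w\leq w'$ iff $w \leq_{\star \varphi} w'$.
   Context: Fix a set $P$ of propositional letters; $\mathcal{L}_0$ is the classical propositional language over $P$. A (well-founded) preference model is $M=\langle W,\leq,v\rangle$ with $W$ a set of worlds, $\leq$ a reflexive, transitive relation on $W$ whose strict part $<$ is well-founded, and $v:P\to 2^W$ a valuation; $\mathit{Mod}(\mathcal{L}_\leq)$ is the class of all such models, and $\mathcal{L}_\leq(P)$ is the language built from $P$ with $\neg,\wedge$, the universal modality $A$, and the modalities $[\leq]$, $[<]$. A dynamic operator is a map $\star:\mathit{Mod}(\mathcal{L}_\leq)\times\mathcal{L}_0\to\mathit{Mod}(\mathcal{L}_\leq)$ with $\star(M,\varphi)=\langle W,\leq_{\star\varphi},v\rangle$ (same worlds and valuation); it is closed over $\mathfrak{M}$ if $\star(M,\varphi)\in\mathfrak{M}$ whenever $M\in\mathfrak{M}$. The language $\mathcal{L}_\leq(\star)$ extends $\mathcal{L}_\leq(P)$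 with formulas $[\star\varphi]\xi$ ($\varphi\in\mathcal{L}_0$), interpreted in a dynamic model $D=\langle M,\star\rangle$ by $D,w\vDash[\star\varphi]\xi$ iff $\langle\star(M,\varphi),\star\rangle,w\vDash\xi$. $[\![\varphi]\!]$ denotes the set of worlds satisfying $\varphi$. $\star$ is $\mathfrak{M}$-DP1-compliant if for every $M\in\mathfrak{M}$, every $\varphi\in\mathcal{L}_0$ and all $w,w'\in[\![\varphi]\!]$, with $D=\langle M,\star\rangle$: (DP1a) if $w\leq_{\star\varphi}w'$ ($w<_{\star\varphi}w'$) then for every $\xi\in\mathcal{L}_\leq(\star)$ with $D,w\vDash[\star\varphi]\xi$ there is $w''\in[\![\varphi]\!]$ with $D,w''\vDash[\star\varphi]\xi$ and $w''\leq w'$ ($w''<w'$); (DP1b) if $w\leq w'$ ($w<w'$) then for every $\xi\in\mathcal{L}_\leq(\star)$ with $D,w\vDash[\star\varphi]\xi$ there is $w''\in[\![\varphi]\!]$ with $D,w''\vDash[\star\varphi]\xi$ and $w''\leq_{\star\varphi}w'$ ($w''<_{\star\varphi}w'$). -}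

module Defs where

open import Level using (0ℓ)
open import Data.Product using (Σ; _×_; _,_)
open import Relation.Nullary using (¬_)
open import Relation.Binary.PropositionalEquality using (_≡_)
open import Induction.WellFounded using (WellFounded)

data Form₀ (P : Set) : Set where
  atom : P → Form₀ P
  neg  : Form₀ P → Form₀ P
  and  : Form₀ P → Form₀ P → Form₀ P

Strict : {W : Set} → (W → W → Set) → W → W → Set
Strict _≤_ x y = x ≤ y × ¬ (y ≤ x)

record PrefModel (P : Set) : Set₁ where
  field
    W      : Set
    _≤_    : W → W → Set
    ≤-refl  : ∀ w → w ≤ w
    ≤-trans : ∀ {u w z} → u ≤ w → w ≤ z → u ≤ z
    <-wf   : WellFounded (Strict _≤_)
    v      : P → W → Set

  _<_ : W → W → Set
  _<_ = Strict _≤_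

open PrefModel public

_,_⊨₀_ : {P : Set} (M : PrefModel P) → W M → Form₀ P → Set
M , w ⊨₀ atom p  = v M p w
M , w ⊨₀ neg φ   = ¬ (M , w ⊨₀ φ)
M , w ⊨₀ and φ ψ = (M , w ⊨₀ φ) × (M , w ⊨₀ ψ)

data Form (P : Set) : Set where
  atom  : P → Form P
  neg   : Form P → Form P
  and   : Form P → Form P → Form P
  A     : Form P → Form P
  box≤  : Form P → Form P
  box<  : Form P → Form P

-- Convention: [≤]ξ (resp. [<]ξ) holds at w iff ξ holds at every w' with
-- w' ≤ w (resp. w' < w), i.e. at all at-least-as-preferred worlds.
_,_⊨_ : {P : Set} (M : PrefModel P) → W M → Form P → Set
M , w ⊨ atom p  = v M p w
M , w ⊨ neg ξ   = ¬ (M , w ⊨ ξ)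
M , w ⊨ and ξ ζ = (M , w ⊨ ξ) × (M , w ⊨ ζ)
M , w ⊨ A ξ     = ∀ w' → M , w' ⊨ ξ
M , w ⊨ box≤ ξ  = ∀ w' → _≤_ M w' w → M , w' ⊨ ξ
M , w ⊨ box< ξ  = ∀ w' → _<_ M w' w → M , w' ⊨ ξ

-- A dynamic operator ⋆ : Mod(L_≤) × L₀ → Mod(L_≤) keeping worlds and
-- valuation; it is given by the new relation ≤_{⋆φ}, which must again be a
-- reflexive, transitive relation with well-founded strict part.
record DynOp (P : Set) : Set₁ where
  field
    rel     : (M : PrefModel P) → Form₀ P → W M → W M → Set
    rel-refl  : ∀ M φ w → rel M φ w w
    rel-trans : ∀ M φ {u w z} → rel M φ u w → rel M φ w z → rel M φ u z
    rel-wf    : ∀ M φ → WellFounded (Strict (rel M φ))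

open DynOp public

apply : {P : Set} → DynOp P → PrefModel P → Form₀ P → PrefModel P
apply ⋆ M φ = record
  { W = W M
  ; _≤_ = rel ⋆ M φ
  ; ≤-refl = rel-refl ⋆ M φ
  ; ≤-trans = rel-trans ⋆ M φ
  ; <-wf = rel-wf ⋆ M φ
  ; v = v M
  }

data DForm (P : Set) : Set where
  atom  : P → DForm P
  neg   : DForm P → DForm P
  and   : DForm P → DForm P → DForm P
  A     : DForm P → DForm P
  box≤  : DForm P → DForm P
  box<  : DForm P → DForm P
  dyn   : Form₀ P → DForm P → DForm P

⟨_,_⟩,_⊨_ : {P : Set} (M : PrefModel P) (⋆ : DynOp P) → W M → DForm P → Set
⟨ M , ⋆ ⟩, w ⊨ atom p  = v M p w
⟨ M , ⋆ ⟩, w ⊨ neg ξ   = ¬ (⟨ M , ⋆ ⟩, w ⊨ ξ)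
⟨ M , ⋆ ⟩, w ⊨ and ξ ζ = (⟨ M , ⋆ ⟩, w ⊨ ξ) × (⟨ M , ⋆ ⟩, w ⊨ ζ)
⟨ M , ⋆ ⟩, w ⊨ A ξ     = ∀ w' → ⟨ M , ⋆ ⟩, w' ⊨ ξ
⟨ M , ⋆ ⟩, w ⊨ box≤ ξ  = ∀ w' → _≤_ M w' w → ⟨ M , ⋆ ⟩, w' ⊨ ξ
⟨ M , ⋆ ⟩, w ⊨ box< ξ  = ∀ w' → _<_ M w' w → ⟨ M , ⋆ ⟩, w' ⊨ ξ
⟨ M , ⋆ ⟩, w ⊨ dyn φ ξ = ⟨ apply ⋆ M φ , ⋆ ⟩, w ⊨ ξ

ModelClass : Set → Set₁
ModelClass P = PrefModel P → Set

HasCharFormulas : {P : Set} → ModelClass P → Set₁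
HasCharFormulas {P} 𝔐 =
  ∀ M → 𝔐 M → ∀ (w : W M) → Σ (Form P) λ ξ →
    ∀ (w' : W M) → ((M , w' ⊨ ξ) → w' ≡ w) × (w' ≡ w → M , w' ⊨ ξ)

ClosedOver : {P : Set} → DynOp P → ModelClass P → Set₁
ClosedOver ⋆ 𝔐 = ∀ M φ → 𝔐 M → 𝔐 (apply ⋆ M φ)

DP1 : {P : Set} → ModelClass P → DynOp P → Set₁
DP1 {P} 𝔐 ⋆ = ∀ M → 𝔐 M → ∀ (φ : Form₀ P) (w w' : W M) →
  M , w ⊨₀ φ → M , w' ⊨₀ φ →
  let ≤⋆ = rel ⋆ M φ ; <⋆ = Strict (rel ⋆ M φ) in
  (≤⋆ w w' → ∀ (ξ : DForm P) → ⟨ M , ⋆ ⟩, w ⊨ dyn φ ξ →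
     Σ (W M) λ w'' → (M , w'' ⊨₀ φ) × (⟨ M , ⋆ ⟩, w'' ⊨ dyn φ ξ) × _≤_ M w'' w')
  ×
  (<⋆ w w' → ∀ (ξ : DForm P) → ⟨ M , ⋆ ⟩, w ⊨ dyn φ ξ →
     Σ (W M) λ w'' → (M , w'' ⊨₀ φ) × (⟨ M , ⋆ ⟩, w'' ⊨ dyn φ ξ) × _<_ M w'' w')
  ×
  (_≤_ M w w' → ∀ (ξ : DForm P) → ⟨ M , ⋆ ⟩, w ⊨ dyn φ ξ →
     Σ (W M) λ w'' → (M , w'' ⊨₀ φ) × (⟨ M , ⋆ ⟩, w'' ⊨ dyn φ ξ) × ≤⋆ w'' w')
  ×
  (_<_ M w w' → ∀ (ξ : DForm P) → ⟨ M , ⋆ ⟩, w ⊨ dyn φ ξ →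
     Σ (W M) λ w'' → (M , w'' ⊨₀ φ) × (⟨ M , ⋆ ⟩, w'' ⊨ dyn φ ξ) × <⋆ w'' w')

PreservesOnφ : {P : Set} → ModelClass P → DynOp P → Set₁
PreservesOnφ {P} 𝔐 ⋆ = ∀ M → 𝔐 M → ∀ (φ : Form₀ P) (w w' : W M) →
  M , w ⊨₀ φ → M , w' ⊨₀ φ →
  (_≤_ M w w' → rel ⋆ M φ w w') × (rel ⋆ M φ w w' → _≤_ M w w')

-- DP1 lets a formula true at w after the update be satisfied by some φ-world
-- standing in the required relation to w'.  Taking for that formula the
-- characteristic formula of w in ⋆(M, φ), which lies in 𝔐 by closure, forces
-- the witness to be w itself; this yields ≤ = ≤_{⋆φ} on [[φ]].  Conversely,
-- if the two relations agree on [[φ]], so do their strict parts, and w is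
-- always a witness for DP1.
module Submission where

open import Defs
open import Data.Product using (Σ; _×_; _,_; proj₁; proj₂)
open import Relation.Binary.PropositionalEquality using (_≡_; refl; subst)

embed : {P : Set} → Form P → DForm P
embed (atom p)  = atom p
embed (neg ξ)   = neg (embed ξ)
embed (and ξ ζ) = and (embed ξ) (embed ζ)
embed (A ξ)     = A (embed ξ)
embed (box≤ ξ)  = box≤ (embed ξ)
embed (box< ξ)  = box< (embed ξ)

⊨-embed : {P : Set} (M : PrefModel P) (⋆ : DynOp P) (ξ : Form P) (w : W M) →
  ((⟨ M , ⋆ ⟩, w ⊨ embed ξ) → M , w ⊨ ξ) × (M , w ⊨ ξ → ⟨ M , ⋆ ⟩, w ⊨ embed ξ)
⊨-embed M ⋆ (atom p) w = (λ x → x) , (λ x → x)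
⊨-embed M ⋆ (neg ξ) w with ⊨-embed M ⋆ ξ w
... | to , from = (λ ¬ξ ξ → ¬ξ (from ξ)) , (λ ¬ξ ξ → ¬ξ (to ξ))
⊨-embed M ⋆ (and ξ ζ) w with ⊨-embed M ⋆ ξ w | ⊨-embed M ⋆ ζ w
... | toξ , fromξ | toζ , fromζ =
  (λ (a , b) → toξ a , toζ b) , (λ (a , b) → fromξ a , fromζ b)
⊨-embed M ⋆ (A ξ) w =
  (λ h w' → proj₁ (⊨-embed M ⋆ ξ w') (h w')) ,
  (λ h w' → proj₂ (⊨-embed M ⋆ ξ w') (h w'))
⊨-embed M ⋆ (box≤ ξ) w =
  (λ h w' le → proj₁ (⊨-embed M ⋆ ξ w') (h w' le)) ,
  (λ h w' le → proj₂ (⊨-embed M ⋆ ξ w') (h w' le))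
⊨-embed M ⋆ (box< ξ) w =
  (λ h w' lt → proj₁ (⊨-embed M ⋆ ξ w') (h w' lt)) ,
  (λ h w' lt → proj₂ (⊨-embed M ⋆ ξ w') (h w' lt))

-- The static formula ξ of the characteristic pair is read in ⋆(M, φ), so
-- [⋆φ]ξ characterises w in the dynamic model ⟨M, ⋆⟩.
dyn-characteristic : {P : Set} (𝔐 : ModelClass P) (⋆ : DynOp P) →
  HasCharFormulas 𝔐 → ClosedOver ⋆ 𝔐 →
  ∀ M → 𝔐 M → (φ : Form₀ P) (w : W M) → Σ (DForm P) λ χ →
    (⟨ M , ⋆ ⟩, w ⊨ dyn φ χ) × (∀ w'' → ⟨ M , ⋆ ⟩, w'' ⊨ dyn φ χ → w'' ≡ w)
dyn-characteristic 𝔐 ⋆ char closed M M∈𝔐 φ w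
  with char (apply ⋆ M φ) (closed M φ M∈𝔐) w
... | ξ , isChar =
  embed ξ ,
  proj₂ (⊨-embed (apply ⋆ M φ) ⋆ ξ w) (proj₂ (isChar w) refl) ,
  λ w'' sat → proj₁ (isChar w'') (proj₁ (⊨-embed (apply ⋆ M φ) ⋆ ξ w'') sat)

witness-is-unique : {W : Set} (R : W → W → Set) {Good Sat : W → Set} {w w' : W} →
  (∀ w'' → Sat w'' → w'' ≡ w) →
  Σ W (λ w'' → Good w'' × Sat w'' × R w'' w') → R w w'
witness-is-unique R {w' = w'} unique (w'' , _ , sat , r) =
  subst (λ u → R u w') (unique w'' sat) r

Strict-transfer : {W : Set} (R S : W → W → Set) {x y : W} →
  (R x y → S x y) → (S y x → R y x) → Strict R x y → Strict S x y
Strict-transfer R S R⇒S S⇒R (r , ¬r) = R⇒S r , λ s → ¬r (S⇒R s)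

DP1⇒PreservesOnφ : {P : Set} (𝔐 : ModelClass P) (⋆ : DynOp P) →
  HasCharFormulas 𝔐 → ClosedOver ⋆ 𝔐 → DP1 𝔐 ⋆ → PreservesOnφ 𝔐 ⋆
DP1⇒PreservesOnφ 𝔐 ⋆ char closed dp1 M M∈𝔐 φ w w' w⊨φ w'⊨φ
  with dp1 M M∈𝔐 φ w w' w⊨φ w'⊨φ | dyn-characteristic 𝔐 ⋆ char closed M M∈𝔐 φ w
... | dp1a , _ , dp1b , _ | χ , χ-at-w , unique =
  (λ le → witness-is-unique (rel ⋆ M φ) unique (dp1b le χ χ-at-w)) ,
  (λ le → witness-is-unique (_≤_ M) unique (dp1a le χ χ-at-w))

PreservesOnφ⇒DP1 : {P : Set} (𝔐 : ModelClass P) (⋆ : DynOp P) →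
  PreservesOnφ 𝔐 ⋆ → DP1 𝔐 ⋆
PreservesOnφ⇒DP1 𝔐 ⋆ agree M M∈𝔐 φ w w' w⊨φ w'⊨φ
  with agree M M∈𝔐 φ w w' w⊨φ w'⊨φ | agree M M∈𝔐 φ w' w w'⊨φ w⊨φ
... | ≤⇒≤⋆ , ≤⋆⇒≤ | ≥⇒≥⋆ , ≥⋆⇒≥ =
  (λ le _ sat → w , w⊨φ , sat , ≤⋆⇒≤ le) ,
  (λ lt _ sat → w , w⊨φ , sat , Strict-transfer (rel ⋆ M φ) (_≤_ M) ≤⋆⇒≤ ≥⇒≥⋆ lt) ,
  (λ le _ sat → w , w⊨φ , sat , ≤⇒≤⋆ le) ,
  (λ lt _ sat → w , w⊨φ , sat , Strict-transfer (_≤_ M) (rel ⋆ M φ) ≤⇒≤⋆ ≥⋆⇒≥ lt)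

fact28 : {P : Set} (𝔐 : ModelClass P) (⋆ : DynOp P) →
    HasCharFormulas 𝔐 → ClosedOver ⋆ 𝔐 →
    (DP1 𝔐 ⋆ → PreservesOnφ 𝔐 ⋆) × (PreservesOnφ 𝔐 ⋆ → DP1 𝔐 ⋆)
fact28 𝔐 ⋆ char closed =
  DP1⇒PreservesOnφ 𝔐 ⋆ char closed , PreservesOnφ⇒DP1 𝔐 ⋆
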